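{- Let $p:\mathrm{GF}(2)^n\to\mathrm{GF}(2)$ be a Boolean function of any degree and $i\neq j$ such that $x_ix_j$ is a term of the algebraic normal form of $p$ and no other term of $p$ is divisible by $x_ix_j$. Then $p$ has a flat spectrum with respect to $U=H_i\cdot H_j$, i.e. every entry of $U(-1)^p$ has absolute value $1$.
   Context: $(-1)^p\in\mathbb C^{2^n}$ has entries $(-1)^{p(x)}$. $H=\frac1{\sqrt2}\begin{pmatrix}1&1\\1&-1\end{pmatrix}$ and $H_k$ is the $n$-fold tensor product with $H$ in the factor corresponding to $x_k$ and the $2\times 2$ identity elsewhere. -}

module Defs where

open import Data.Bool using (Bool; true; false; _∧_; _∨_; _xor_; not; if_then_else_)
open import Data.Nat using (ℕ; zero; suc)
open import Data.Fin using (Fin; _≟_)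
open import Data.Vec using (Vec; []; _∷_; tabulate; lookup; _[_]≔_)
open import Data.List using (List; []; _∷_; map; foldr; _++_)
open import Data.Integer using (ℤ; _+_; _*_; -_; +_)
open import Relation.Nullary.Decidable using (⌊_⌋)

-- A Boolean function GF(2)^n → GF(2); GF(2) is modelled by Bool
-- (true = 1, false = 0, addition = xor, multiplication = ∧).
BoolFun : ℕ → Set
BoolFun n = Vec Bool n → Bool

allVec : (n : ℕ) → List (Vec Bool n)
allVec zero = [] ∷ []
allVec (suc n) = map (false ∷_) (allVec n) ++ map (true ∷_) (allVec n)

_≤ᵇ_ : ∀ {n} → Vec Bool n → Vec Bool n → Bool
[] ≤ᵇ [] = true
(a ∷ x) ≤ᵇ (b ∷ S) = (not a ∨ b) ∧ (x ≤ᵇ S)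

-- Coefficient of the monomial ∏_{k ∈ S} x_k in the algebraic normal form
-- of p (Möbius transform over GF(2)):  a_S = ⊕_{x ⊆ S} p(x).
anfCoeff : ∀ {n} → BoolFun n → Vec Bool n → Bool
anfCoeff {n} p S = foldr _xor_ false (map (λ x → (x ≤ᵇ S) ∧ p x) (allVec n))

monoij : ∀ {n} → Fin n → Fin n → Vec Bool n
monoij i j = tabulate (λ k → ⌊ k ≟ i ⌋ ∨ ⌊ k ≟ j ⌋)

sgn : Bool → ℤ
sgn false = + 1
sgn true  = - (+ 1)

signVec : ∀ {n} → BoolFun n → Vec Bool n → ℤ
signVec p x = sgn (p x)

-- Unnormalised Hadamard acting on factor k:  √2 · H_k.
-- (√2 H_k v)(y) = Σ_{a ∈ {0,1}} (-1)^{y_k a} v(y with y_k := a).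
sqrt2H : ∀ {n} → Fin n → (Vec Bool n → ℤ) → (Vec Bool n → ℤ)
sqrt2H k v y = v (y [ k ]≔ false) + sgn (lookup y k) * v (y [ k ]≔ true)

-- The entry of (√2 Hᵢ)(√2 Hⱼ)(-1)^p at y is a signed sum of the four values
-- (-1)^p(y with yᵢ, yⱼ := a, b); four signs sum to ±2 exactly when their
-- product is -1, i.e. when the second derivative ΔᵢΔⱼp(y) is 1. Writing p
-- through its algebraic normal form, ΔᵢΔⱼp(y) is the sum of the coefficients
-- of the monomials divisible by xᵢxⱼ whose remaining variables lie in the
-- support of y, and by hypothesis only the coefficient of xᵢxⱼ survives.
module Submission where

open import Defs
open import Algebra.Bundles using (CommutativeRing)
open import Data.Empty using (⊥-elim)
open import Data.Bool using (Bool; true; false; _∧_; _∨_; _xor_)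
open import Data.Bool.Properties
  using (xor-assoc; xor-identityʳ; xor-annihilates-not; not-involutive;
         ∧-assoc; ∧-zeroʳ; ∧-distribˡ-xor; xor-∧-commutativeRing)
open import Algebra.Properties.CommutativeSemigroup
  (CommutativeRing.+-commutativeSemigroup xor-∧-commutativeRing)
  using (interchange; x∙yz≈y∙xz)
open import Data.Fin using (Fin; _≟_) renaming (zero to fzero; suc to fsuc)
open import Data.Integer using (∣_∣; _+_; _*_)
open import Data.Integer.Properties using (*-distribˡ-+)
open import Data.List using (List; []; _∷_; map; foldr; _++_)
open import Data.List.Properties using (map-++; map-∘; map-cong)
open import Data.Nat using (ℕ; zero; suc)
open import Data.Sum using (_⊎_; inj₁; inj₂)
open import Data.Vec using (Vec; []; _∷_; lookup; tail; _[_]≔_)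
open import Data.Vec.Properties using (lookup∘tabulate; lookup∘update; lookup∘update′; []≔-commutes)
open import Function using (_∘_)
open import Relation.Binary.PropositionalEquality
open import Relation.Nullary using (yes; no)
open import Relation.Nullary.Decidable using (⌊_⌋)

open ≡-Reasoning

xor-cancelˡ : ∀ x y → x xor (x xor y) ≡ y
xor-cancelˡ false y = refl
xor-cancelˡ true  y = not-involutive y

xor-cancel-both : ∀ s x y → (s xor x) xor (s xor y) ≡ x xor y
xor-cancel-both false x y = refl
xor-cancel-both true  x y = xor-annihilates-not x y

xor-∧-interchange : ∀ a b c d e →
  (a xor (b ∧ c)) xor (d xor (b ∧ e)) ≡ (a xor d) xor (b ∧ (c xor e))
xor-∧-interchange a b c d e =
  trans (interchange a (b ∧ c) d (b ∧ e)) (cong ((a xor d) xor_) (sym (∧-distribˡ-xor b c e)))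

xorSum : List Bool → Bool
xorSum = foldr _xor_ false

xorSum-++ : ∀ xs ys → xorSum (xs ++ ys) ≡ xorSum xs xor xorSum ys
xorSum-++ []       ys = refl
xorSum-++ (x ∷ xs) ys = trans (cong (x xor_) (xorSum-++ xs ys)) (sym (xor-assoc x (xorSum xs) (xorSum ys)))

xorSum-∧ˡ : ∀ {A : Set} b (f : A → Bool) xs → xorSum (map (λ x → b ∧ f x) xs) ≡ b ∧ xorSum (map f xs)
xorSum-∧ˡ b f []       = sym (∧-zeroʳ b)
xorSum-∧ˡ b f (x ∷ xs) =
  trans (cong ((b ∧ f x) xor_) (xorSum-∧ˡ b f xs)) (sym (∧-distribˡ-xor b (f x) (xorSum (map f xs))))

sumᵥ : ∀ n → (Vec Bool n → Bool) → Bool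
sumᵥ n f = xorSum (map f (allVec n))

sumᵥ-suc : ∀ n f → sumᵥ (suc n) f ≡ sumᵥ n (f ∘ (false ∷_)) xor sumᵥ n (f ∘ (true ∷_))
sumᵥ-suc n f = begin
  xorSum (map f (map (false ∷_) (allVec n) ++ map (true ∷_) (allVec n)))
    ≡⟨ cong xorSum (map-++ f (map (false ∷_) (allVec n)) _) ⟩
  xorSum (map f (map (false ∷_) (allVec n)) ++ map f (map (true ∷_) (allVec n)))
    ≡⟨ xorSum-++ (map f (map (false ∷_) (allVec n))) _ ⟩
  xorSum (map f (map (false ∷_) (allVec n))) xor xorSum (map f (map (true ∷_) (allVec n)))
    ≡⟨ sym (cong₂ (λ u v → xorSum u xor xorSum v) (map-∘ (allVec n)) (map-∘ (allVec n))) ⟩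
  sumᵥ n (f ∘ (false ∷_)) xor sumᵥ n (f ∘ (true ∷_)) ∎

sumᵥ-cong : ∀ n {f g : Vec Bool n → Bool} → f ≗ g → sumᵥ n f ≡ sumᵥ n g
sumᵥ-cong n f≗g = cong xorSum (map-cong f≗g (allVec n))

möbius : ∀ {n} → (Vec Bool n → Bool) → Vec Bool n → Bool
möbius {zero}  f []      = f []
möbius {suc n} f (b ∷ x) = möbius (f ∘ (false ∷_)) x xor (b ∧ möbius (f ∘ (true ∷_)) x)

anfCoeff≗möbius : ∀ {n} (p : BoolFun n) → anfCoeff p ≗ möbius p
anfCoeff≗möbius {zero}  p []      = xor-identityʳ (p [])
anfCoeff≗möbius {suc n} p (b ∷ S) = begin
  sumᵥ (suc n) (λ x → (x ≤ᵇ (b ∷ S)) ∧ p x)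
    ≡⟨ sumᵥ-suc n _ ⟩
  anfCoeff (p ∘ (false ∷_)) S xor sumᵥ n (λ x → (b ∧ (x ≤ᵇ S)) ∧ p (true ∷ x))
    ≡⟨ cong (anfCoeff (p ∘ (false ∷_)) S xor_)
         (trans (sumᵥ-cong n (λ x → ∧-assoc b _ _)) (xorSum-∧ˡ b _ (allVec n))) ⟩
  anfCoeff (p ∘ (false ∷_)) S xor (b ∧ anfCoeff (p ∘ (true ∷_)) S)
    ≡⟨ cong₂ (λ u v → u xor (b ∧ v)) (anfCoeff≗möbius _ S) (anfCoeff≗möbius _ S) ⟩
  möbius p (b ∷ S) ∎

möbius-cong : ∀ {n} {f g : Vec Bool n → Bool} → f ≗ g → möbius f ≗ möbius g
möbius-cong {zero}  f≗g []      = f≗g []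
möbius-cong {suc n} f≗g (b ∷ x) =
  cong₂ (λ u v → u xor (b ∧ v)) (möbius-cong (f≗g ∘ (false ∷_)) x) (möbius-cong (f≗g ∘ (true ∷_)) x)

möbius-xor : ∀ {n} (f g : Vec Bool n → Bool) → möbius (λ S → f S xor g S) ≗ λ x → möbius f x xor möbius g x
möbius-xor {zero}  f g []      = refl
möbius-xor {suc n} f g (b ∷ x) =
  trans (cong₂ (λ u v → u xor (b ∧ v)) (möbius-xor _ _ x) (möbius-xor _ _ x))
        (sym (xor-∧-interchange (möbius (f ∘ (false ∷_)) x) b _ _ _))

möbius-zero : ∀ {n} {f : Vec Bool n → Bool} → (∀ S → f S ≡ false) → ∀ x → möbius f x ≡ false
möbius-zero {zero}  f≡0 []      = f≡0 []
möbius-zero {suc n} f≡0 (b ∷ x)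
  rewrite möbius-zero (f≡0 ∘ (false ∷_)) x | möbius-zero (f≡0 ∘ (true ∷_)) x = ∧-zeroʳ b

möbius-involutive : ∀ {n} (p : Vec Bool n → Bool) → möbius (möbius p) ≗ p
möbius-involutive {zero}  p []      = refl
möbius-involutive {suc n} p (b ∷ x) = begin
  möbius (λ S → p₀′ S xor false) x xor (b ∧ möbius (λ S → p₀′ S xor p₁′ S) x)
    ≡⟨ cong₂ (λ u v → u xor (b ∧ v))
         (trans (möbius-cong (xor-identityʳ ∘ p₀′) x) (möbius-involutive p₀ x))
         (trans (möbius-xor p₀′ p₁′ x) (cong₂ _xor_ (möbius-involutive p₀ x) (möbius-involutive p₁ x))) ⟩
  p₀ x xor (b ∧ (p₀ x xor p₁ x))
    ≡⟨ select b ⟩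
  p (b ∷ x) ∎
  where
  p₀ p₁ p₀′ p₁′ : _ → Bool
  p₀ = p ∘ (false ∷_)
  p₁ = p ∘ (true ∷_)
  p₀′ = möbius p₀
  p₁′ = möbius p₁
  select : ∀ b → p₀ x xor (b ∧ (p₀ x xor p₁ x)) ≡ p (b ∷ x)
  select false = xor-identityʳ (p₀ x)
  select true  = xor-cancelˡ (p₀ x) (p₁ x)

möbius-anfCoeff : ∀ {n} (p : BoolFun n) → möbius (anfCoeff p) ≗ p
möbius-anfCoeff p x = trans (möbius-cong (anfCoeff≗möbius p) x) (möbius-involutive p x)

Δ : ∀ {n} → Fin n → (Vec Bool n → Bool) → Vec Bool n → Bool
Δ k f x = f (x [ k ]≔ false) xor f (x [ k ]≔ true)

Δ-cong : ∀ {n} (k : Fin n) {f g : Vec Bool n → Bool} → f ≗ g → Δ k f ≗ Δ k g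
Δ-cong k f≗g x = cong₂ _xor_ (f≗g _) (f≗g _)

Δ-möbius : ∀ {n} (k : Fin n) (c : Vec Bool n → Bool) x →
  Δ k (möbius c) x ≡ möbius (λ S → lookup S k ∧ c S) (x [ k ]≔ true)
Δ-möbius fzero c (b ∷ x) = begin
  (A xor false) xor (A xor B)  ≡⟨ cong (_xor (A xor B)) (xor-identityʳ A) ⟩
  A xor (A xor B)              ≡⟨ xor-cancelˡ A B ⟩
  B                            ≡⟨ cong (_xor B) (sym (möbius-zero (λ _ → refl) x)) ⟩
  möbius (λ _ → false) x xor B ∎
  where
  A = möbius (c ∘ (false ∷_)) x
  B = möbius (c ∘ (true ∷_)) x
Δ-möbius (fsuc k) c (b ∷ x) =
  trans (xor-∧-interchange (möbius (c ∘ (false ∷_)) (x [ k ]≔ false)) b _ _ _)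
        (cong₂ (λ u v → u xor (b ∧ v)) (Δ-möbius k _ x) (Δ-möbius k _ x))

Δ²-möbius : ∀ {n} {i j : Fin n} → i ≢ j → (c : Vec Bool n → Bool) → ∀ y →
  Δ i (Δ j (möbius c)) y ≡ möbius (λ S → lookup S i ∧ (lookup S j ∧ c S)) ((y [ j ]≔ true) [ i ]≔ true)
Δ²-möbius {i = i} {j} i≢j c y = begin
  Δ i (Δ j (möbius c)) y
    ≡⟨ Δ-cong i (Δ-möbius j c) y ⟩
  möbius cⱼ ((y [ i ]≔ false) [ j ]≔ true) xor möbius cⱼ ((y [ i ]≔ true) [ j ]≔ true)
    ≡⟨ cong₂ (λ u v → möbius cⱼ u xor möbius cⱼ v) ([]≔-commutes y i j i≢j) ([]≔-commutes y i j i≢j) ⟩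
  Δ i (möbius cⱼ) (y [ j ]≔ true)
    ≡⟨ Δ-möbius i cⱼ (y [ j ]≔ true) ⟩
  möbius (λ S → lookup S i ∧ (lookup S j ∧ c S)) ((y [ j ]≔ true) [ i ]≔ true) ∎
  where
  cⱼ : _ → Bool
  cⱼ S = lookup S j ∧ c S

möbius-single : ∀ {n} (c : Vec Bool n → Bool) (T w : Vec Bool n) →
  (∀ S → S ≢ T → c S ≡ false) → T ≤ᵇ w ≡ true → möbius c w ≡ c T
möbius-single c [] [] _ _ = refl
möbius-single c (false ∷ T) (b ∷ w) c≡0 T≤w = begin
  möbius (c ∘ (false ∷_)) w xor (b ∧ möbius (c ∘ (true ∷_)) w)
    ≡⟨ cong₂ (λ u v → u xor (b ∧ v))
         (möbius-single _ T w (λ S S≢T → c≡0 _ (S≢T ∘ cong tail)) T≤w)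
         (möbius-zero (λ S → c≡0 _ λ ()) w) ⟩
  c (false ∷ T) xor (b ∧ false)
    ≡⟨ trans (cong (c (false ∷ T) xor_) (∧-zeroʳ b)) (xor-identityʳ _) ⟩
  c (false ∷ T) ∎
möbius-single c (true ∷ T) (true ∷ w) c≡0 T≤w =
  cong₂ _xor_ (möbius-zero (λ S → c≡0 _ λ ()) w)
              (möbius-single _ T w (λ S S≢T → c≡0 _ (S≢T ∘ cong tail)) T≤w)

lookup⇒≤ᵇ : ∀ {n} (T w : Vec Bool n) → (∀ k → lookup T k ≡ true → lookup w k ≡ true) → T ≤ᵇ w ≡ true
lookup⇒≤ᵇ []          []      _   = refl
lookup⇒≤ᵇ (false ∷ T) (b ∷ w) T⊆w = lookup⇒≤ᵇ T w (T⊆w ∘ fsuc)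
lookup⇒≤ᵇ (true ∷ T)  (b ∷ w) T⊆w rewrite T⊆w fzero refl = lookup⇒≤ᵇ T w (T⊆w ∘ fsuc)

lookup-monoij : ∀ {n} (i j k : Fin n) → k ≡ i ⊎ k ≡ j → lookup (monoij i j) k ≡ true
lookup-monoij i j k k∈ij rewrite lookup∘tabulate (λ k → ⌊ k ≟ i ⌋ ∨ ⌊ k ≟ j ⌋) k
  with k ≟ i | k ≟ j | k∈ij
... | yes _  | _      | _        = refl
... | no _   | yes _  | _        = refl
... | no k≢i | no _   | inj₁ k≡i = ⊥-elim (k≢i k≡i)
... | no _   | no k≢j | inj₂ k≡j = ⊥-elim (k≢j k≡j)

monoij-support : ∀ {n} (i j k : Fin n) → lookup (monoij i j) k ≡ true → k ≡ i ⊎ k ≡ j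
monoij-support i j k kᵢⱼ rewrite lookup∘tabulate (λ k → ⌊ k ≟ i ⌋ ∨ ⌊ k ≟ j ⌋) k
  with k ≟ i | k ≟ j | kᵢⱼ
... | yes k≡i | _       | _ = inj₁ k≡i
... | no _    | yes k≡j | _ = inj₂ k≡j
... | no _    | no _    | ()

monoij-≤ᵇ : ∀ {n} (i j : Fin n) (w : Vec Bool n) → lookup w i ≡ true → lookup w j ≡ true → monoij i j ≤ᵇ w ≡ true
monoij-≤ᵇ i j w wᵢ wⱼ = lookup⇒≤ᵇ (monoij i j) w λ k kᵢⱼ → [ k ]-of (monoij-support i j k kᵢⱼ)
  where
  [_]-of : ∀ k → k ≡ i ⊎ k ≡ j → lookup w k ≡ true
  [ k ]-of (inj₁ refl) = wᵢ
  [ k ]-of (inj₂ refl) = wⱼ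

sgn-xor : ∀ a b → sgn a * sgn b ≡ sgn (a xor b)
sgn-xor false false = refl
sgn-xor false true  = refl
sgn-xor true  false = refl
sgn-xor true  true  = refl

four-signs : ∀ a b c d → (a xor b) xor (c xor d) ≡ true → ∣ (sgn a + sgn b) + (sgn c + sgn d) ∣ ≡ 2
four-signs false false false false ()
four-signs false false false true  _ = refl
four-signs false false true  false _ = refl
four-signs false false true  true  ()
four-signs false true  false false _ = refl
four-signs false true  false true  ()
four-signs false true  true  false ()
four-signs false true  true  true  _ = refl
four-signs true  false false false _ = refl
four-signs true  false false true  ()
four-signs true  false true  false ()
four-signs true  false true  true  _ = refl
four-signs true  true  false false ()
four-signs true  true  false true  _ = refl
four-signs true  true  true  false _ = refl
four-signs true  true  true  true  ()

hadamard²-entry : ∀ s t a b c d → (a xor b) xor (c xor d) ≡ true →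
  ∣ (sgn a + sgn t * sgn b) + sgn s * (sgn c + sgn t * sgn d) ∣ ≡ 2
hadamard²-entry s t a b c d odd = begin
  ∣ (sgn a + sgn t * sgn b) + sgn s * (sgn c + sgn t * sgn d) ∣
    ≡⟨ cong ∣_∣ (cong₂ _+_ (cong (sgn a +_) (sgn-xor t b)) signs-sd) ⟩
  ∣ (sgn a + sgn (t xor b)) + (sgn (s xor c) + sgn (s xor (t xor d))) ∣
    ≡⟨ four-signs a (t xor b) (s xor c) (s xor (t xor d)) (trans parity odd) ⟩
  2 ∎
  where
  signs-sd : sgn s * (sgn c + sgn t * sgn d) ≡ sgn (s xor c) + sgn (s xor (t xor d))
  signs-sd = begin
    sgn s * (sgn c + sgn t * sgn d)           ≡⟨ cong (λ u → sgn s * (sgn c + u)) (sgn-xor t d) ⟩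
    sgn s * (sgn c + sgn (t xor d))           ≡⟨ *-distribˡ-+ (sgn s) (sgn c) _ ⟩
    sgn s * sgn c + sgn s * sgn (t xor d)     ≡⟨ cong₂ _+_ (sgn-xor s c) (sgn-xor s (t xor d)) ⟩
    sgn (s xor c) + sgn (s xor (t xor d))     ∎
  parity : (a xor (t xor b)) xor ((s xor c) xor (s xor (t xor d))) ≡ (a xor b) xor (c xor d)
  parity = begin
    (a xor (t xor b)) xor ((s xor c) xor (s xor (t xor d)))
      ≡⟨ cong ((a xor (t xor b)) xor_) (xor-cancel-both s c (t xor d)) ⟩
    (a xor (t xor b)) xor (c xor (t xor d))
      ≡⟨ cong₂ _xor_ (x∙yz≈y∙xz a t b) (x∙yz≈y∙xz c t d) ⟩
    (t xor (a xor b)) xor (t xor (c xor d))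
      ≡⟨ xor-cancel-both t (a xor b) (c xor d) ⟩
    (a xor b) xor (c xor d) ∎

Δ²-isolated-monomial : ∀ {n} (p : BoolFun n) {i j : Fin n} → i ≢ j →
  anfCoeff p (monoij i j) ≡ true →
  (∀ S → lookup S i ≡ true → lookup S j ≡ true → S ≢ monoij i j → anfCoeff p S ≡ false) →
  ∀ y → Δ i (Δ j p) y ≡ true
Δ²-isolated-monomial {n} p {i} {j} i≢j aᵢⱼ≡1 a≡0 y = begin
  Δ i (Δ j p) y                      ≡⟨ Δ-cong i (Δ-cong j (sym ∘ möbius-anfCoeff p)) y ⟩
  Δ i (Δ j (möbius (anfCoeff p))) y  ≡⟨ Δ²-möbius i≢j (anfCoeff p) y ⟩
  möbius cᵢⱼ w                       ≡⟨ möbius-single cᵢⱼ (monoij i j) w cᵢⱼ-single (monoij-≤ᵇ i j w wᵢ wⱼ) ⟩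
  cᵢⱼ (monoij i j)                   ≡⟨ cᵢⱼ-monoij ⟩
  true                               ∎
  where
  cᵢⱼ : Vec Bool n → Bool
  cᵢⱼ S = lookup S i ∧ (lookup S j ∧ anfCoeff p S)
  cᵢⱼ-single : ∀ S → S ≢ monoij i j → cᵢⱼ S ≡ false
  cᵢⱼ-single S S≢ij with lookup S i in Sᵢ | lookup S j in Sⱼ
  ... | false | _     = refl
  ... | true  | false = refl
  ... | true  | true  = a≡0 S Sᵢ Sⱼ S≢ij
  cᵢⱼ-monoij : cᵢⱼ (monoij i j) ≡ true
  cᵢⱼ-monoij rewrite lookup-monoij i j i (inj₁ refl) | lookup-monoij i j j (inj₂ refl) = aᵢⱼ≡1
  w : Vec Bool n
  w = (y [ j ]≔ true) [ i ]≔ true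
  wᵢ : lookup w i ≡ true
  wᵢ = lookup∘update i (y [ j ]≔ true) true
  wⱼ : lookup w j ≡ true
  wⱼ = trans (lookup∘update′ (i≢j ∘ sym) (y [ j ]≔ true) true) (lookup∘update j y true)

corollary1 : (n : ℕ) (p : BoolFun n) (i j : Fin n) → i ≢ j →
    anfCoeff p (monoij i j) ≡ true →
    ((S : Vec Bool n) → lookup S i ≡ true → lookup S j ≡ true →
      S ≢ monoij i j → anfCoeff p S ≡ false) →
    (y : Vec Bool n) → ∣ sqrt2H i (sqrt2H j (signVec p)) y ∣ ≡ 2
corollary1 n p i j i≢j aᵢⱼ≡1 a≡0 y
  rewrite lookup∘update′ (i≢j ∘ sym) y false | lookup∘update′ (i≢j ∘ sym) y true =
  hadamard²-entry (lookup y i) (lookup y j) (p (yᵢⱼ false false)) (p (yᵢⱼ false true))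
                  (p (yᵢⱼ true false)) (p (yᵢⱼ true true))
                  (Δ²-isolated-monomial p i≢j aᵢⱼ≡1 a≡0 y)
  where
  yᵢⱼ : Bool → Bool → Vec Bool n
  yᵢⱼ a b = (y [ i ]≔ a) [ j ]≔ b
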